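{- Let $(g,f)$ be a semi-retraction between structures $\mathcal{A}$ and $\mathcal{B}$. Let $\mathbf{D}$ be the category whose objects are finite tuples from $\mathcal{A}$ and whose morphisms are qftp-preserving injections, and let $\mathbf{C}$ be the analogous category for $\mathcal{B}$. Define $F:\mathrm{Obj}(\mathbf{D})\to\mathrm{Obj}(\mathbf{C})$ by $F(\bar a)=g(\bar a)$ and $G:\mathrm{Obj}(\mathbf{C})\to\mathrm{Obj}(\mathbf{D})$ by $G(\bar c)=f(\bar c)$. Then $(F,G)$ is a pre-adjunction.
   Context: An injection $h:\mathcal{A}\to\mathcal{B}$ (signatures may differ) is qftp-respecting if for all finite same-length tuples $\bar\imath,\bar\jmath$ from $\mathcal{A}$, $\mathrm{qftp}^{\mathcal{A}}(\bar\imath)=\mathrm{qftp}^{\mathcal{A}}(\bar\jmath)$ implies $\mathrm{qftp}^{\mathcal{B}}(h(\bar\imath))=\mathrm{qftp}^{\mathcal{B}}(h(\bar\jmath))$. $(g,f)$ is a semi-retraction between $\mathcal{A}$ and $\mathcal{B}$ if $g:\mathcal{A}\to\mathcal{B}$, $f:\mathcal{B}\to\mathcal{A}$ are qftp-respecting injections and $f\circ g$ is an embedding. A morphism in $\mathbf{D}$ from $\bar a$ to $\bar b$ is an injection $\psi:\mathrm{ran}\,\bar a\to\mathrm{ran}\,\bar b$ such that $\mathrm{qftp}^{\mathcal{A}}(\bar x)=\mathrm{qftp}^{\mathcal{A}}(\psi(\bar x))$ for every tuple $\bar x$ from $\mathrm{ran}\,\bar a$ (similarly for $\mathbf{C}$).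 For categories $\mathbf{C},\mathbf{D}$ and maps on objects $F:\mathrm{Obj}(\mathbf{D})\to\mathrm{Obj}(\mathbf{C})$, $G:\mathrm{Obj}(\mathbf{C})\to\mathrm{Obj}(\mathbf{D})$, $(F,G)$ is a pre-adjunction if there are maps $\Phi_{A,C}:\hom_{\mathbf{C}}(F(A),C)\to\hom_{\mathbf{D}}(A,G(C))$ for all $A\in\mathrm{Obj}(\mathbf{D})$, $C\in\mathrm{Obj}(\mathbf{C})$, such that for all $A,B\in\mathrm{Obj}(\mathbf{D})$, $C\in\mathrm{Obj}(\mathbf{C})$, $v\in\hom_{\mathbf{D}}(A,B)$ and $\psi\in\hom_{\mathbf{C}}(F(B),C)$ there exists $w\in\hom_{\mathbf{C}}(F(A),F(B))$ with $\Phi_{A,C}(\psi\circ w)=\Phi_{B,C}(\psi)\circ v$. -}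

module Defs where

open import Data.Nat using (ℕ)
open import Data.Fin using (Fin)
open import Data.Vec using (Vec; []; _∷_; map; lookup)
open import Data.Vec.Properties using (map-∘)
open import Data.Vec.Membership.Propositional using (_∈_)
open import Data.Product using (Σ; _×_; _,_; proj₁; proj₂)
open import Function using (_∘_; _⇔_; mk⇔; Equivalence)
open import Function.Definitions using (Injective)
open import Relation.Binary.PropositionalEquality
  using (_≡_; refl; sym; trans; cong; subst)

record Signature : Set₁ where
  field
    Rel    : Set
    rarity : Rel → ℕ
    Fun    : Set
    farity : Fun → ℕ
open Signature public

record Structure (L : Signature) : Set₁ where
  field
    Carrier : Set
    relI    : (R : Rel L) → Vec Carrier (rarity L R) → Set
    funI    : (F : Fun L) → Vec Carrier (farity L F) → Carrier
open Structure public

data Term (L : Signature) (n : ℕ) : Set where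
  var : Fin n → Term L n
  app : (F : Fun L) → Vec (Term L n) (farity L F) → Term L n

data QF (L : Signature) (n : ℕ) : Set where
  _≐_  : Term L n → Term L n → QF L n
  rel  : (R : Rel L) → Vec (Term L n) (rarity L R) → QF L n
  ¬'_  : QF L n → QF L n
  _∧'_ : QF L n → QF L n → QF L n

module _ {L : Signature} (M : Structure L) where
  mutual
    eval : ∀ {n} → Term L n → Vec (Carrier M) n → Carrier M
    eval (var i)    a = lookup a i
    eval (app F ts) a = funI M F (evals ts a)

    evals : ∀ {n k} → Vec (Term L n) k → Vec (Carrier M) n → Vec (Carrier M) k
    evals []       a = []
    evals (t ∷ ts) a = eval t a ∷ evals ts a

  Sat : ∀ {n} → QF L n → Vec (Carrier M) n → Set
  Sat (s ≐ t)    a = eval s a ≡ eval t a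
  Sat (rel R ts) a = relI M R (evals ts a)
  Sat (¬' φ)     a = Sat φ a → Data.Empty.⊥
    where import Data.Empty
  Sat (φ ∧' ψ)   a = Sat φ a × Sat ψ a

  SameQftp : ∀ {n} → Vec (Carrier M) n → Vec (Carrier M) n → Set
  SameQftp a b = ∀ (φ : QF L _) → Sat φ a ⇔ Sat φ b

module _ {L L' : Signature} (A : Structure L) (B : Structure L') where
  QftpRespecting : (Carrier A → Carrier B) → Set
  QftpRespecting h =
    Injective _≡_ _≡_ h ×
    (∀ n (i j : Vec (Carrier A) n) →
       SameQftp A i j → SameQftp B (map h i) (map h j))

module _ {L : Signature} (A : Structure L) where
  IsEmbedding : (Carrier A → Carrier A) → Set
  IsEmbedding h =
    Injective _≡_ _≡_ h ×
    (∀ (R : Rel L) xs → relI A R xs ⇔ relI A R (map h xs)) ×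
    (∀ (F : Fun L) xs → h (funI A F xs) ≡ funI A F (map h xs))

module _ {L L' : Signature} (A : Structure L) (B : Structure L') where
  IsSemiRetraction : (Carrier A → Carrier B) → (Carrier B → Carrier A) → Set
  IsSemiRetraction g f =
    QftpRespecting A B g × QftpRespecting B A f × IsEmbedding A (f ∘ g)

record PreCat : Set₁ where
  field
    Obj  : Set
    Hom  : Obj → Obj → Set
    _∘ₕ_ : ∀ {X Y Z} → Hom Y Z → Hom X Y → Hom X Z
    _≈_  : ∀ {X Y} → Hom X Y → Hom X Y → Set

module _ (C D : PreCat) where
  private
    module C = PreCat C
    module D = PreCat D

  IsPreAdjunction : (D.Obj → C.Obj) → (C.Obj → D.Obj) → Set
  IsPreAdjunction F G =
    Σ (∀ (A : D.Obj) (X : C.Obj) → C.Hom (F A) X → D.Hom A (G X)) λ Φ →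
      ∀ (A B : D.Obj) (X : C.Obj) (v : D.Hom A B) (ψ : C.Hom (F B) X) →
        Σ (C.Hom (F A) (F B)) λ w →
          Φ A X (ψ C.∘ₕ w) D.≈ (Φ B X ψ D.∘ₕ v)

module _ {L : Signature} (M : Structure L) where
  TupObj : Set
  TupObj = Σ ℕ (Vec (Carrier M))

  Ran : TupObj → Set
  Ran (_ , a) = Σ (Carrier M) (_∈ a)

  record TupHom (a b : TupObj) : Set where
    field
      fun  : Ran a → Ran b
      -- depends only on the element (not on the membership witness)
      wd   : ∀ x y → proj₁ x ≡ proj₁ y → proj₁ (fun x) ≡ proj₁ (fun y)
      inj  : ∀ x y → proj₁ (fun x) ≡ proj₁ (fun y) → proj₁ x ≡ proj₁ y
      pres : ∀ k (xs : Vec (Ran a) k) →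
               SameQftp M (map proj₁ xs) (map (proj₁ ∘ fun) xs)
  open TupHom public

  _≈T_ : ∀ {a b} → TupHom a b → TupHom a b → Set
  φ ≈T ψ = ∀ x → proj₁ (fun φ x) ≡ proj₁ (fun ψ x)

  _∘T_ : ∀ {a b c} → TupHom b c → TupHom a b → TupHom a c
  fun (ψ ∘T φ) = fun ψ ∘ fun φ
  wd  (ψ ∘T φ) x y e = wd ψ _ _ (wd φ x y e)
  inj (ψ ∘T φ) x y e = inj φ x y (inj ψ _ _ e)
  pres (ψ ∘T φ) k xs θ =
    let e1 = pres φ k xs θ
        e2 = pres ψ k (map (fun φ) xs) θ
        eq1 : map proj₁ (map (fun φ) xs) ≡ map (proj₁ ∘ fun φ) xs
        eq1 = sym (map-∘ proj₁ (fun φ) xs)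
        eq2 : map (proj₁ ∘ fun ψ) (map (fun φ) xs) ≡ map (proj₁ ∘ fun ψ ∘ fun φ) xs
        eq2 = sym (map-∘ (proj₁ ∘ fun ψ) (fun φ) xs)
        to' = λ s → subst (Sat M θ) eq2
                      (Equivalence.to e2 (subst (Sat M θ) (sym eq1) (Equivalence.to e1 s)))
        from' = λ s → Equivalence.from e1 (subst (Sat M θ) eq1
                      (Equivalence.from e2 (subst (Sat M θ) (sym eq2) s)))
    in mk⇔ to' from'

  TupCat : PreCat
  TupCat = record { Obj = TupObj ; Hom = TupHom ; _∘ₕ_ = _∘T_ ; _≈_ = _≈T_ }

mapTup : {L L' : Signature} {A : Structure L} {B : Structure L'} →
         (Carrier A → Carrier B) → TupObj A → TupObj B
mapTup h (n , a) = n , map h a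

{-# OPTIONS --safe #-}
-- Take Φ(ψ) = f ∘ ψ ∘ g. It preserves qftp because f ∘ g is an embedding, so
-- qftp(x̄) = qftp(f(g(x̄))), and f respects qftp, so qftp(f(g(x̄))) = qftp(f(ψ(g(x̄)))).
-- Any qftp-respecting injection h transports a morphism φ to h ∘ φ ∘ h⁻¹; thus
-- Φ(ψ) = (f ∘ ψ ∘ f⁻¹) ∘ (f ∘ g), and for v : ā → b̄ the witness w = g ∘ v ∘ g⁻¹
-- makes both Φ(ψ ∘ w) and Φ(ψ) ∘ v equal to f ∘ ψ ∘ g ∘ v.
module Submission where

open import Defs
open import Data.Nat using (ℕ)
open import Data.Vec using (Vec; []; _∷_; map)
open import Data.Vec.Properties using (map-∘; map-cong; lookup-map)
open import Data.Vec.Membership.Propositional using (_∈_; find)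
open import Data.Vec.Membership.Propositional.Properties using (∈-map⁺)
open import Data.Vec.Relation.Unary.Any.Properties using (map⁻)
open import Data.Product using (∃; _×_; _,_; proj₁; proj₂)
open import Data.Product.Function.NonDependent.Propositional using (_×-⇔_)
open import Function using (_∘_; _⇔_; mk⇔)
open import Function.Properties.Equivalence using (⇔-isEquivalence)
open import Function.Related.TypeIsomorphisms using (¬-cong-⇔)
open import Relation.Binary.Bundles using (Setoid)
open import Relation.Binary.Structures using (IsEquivalence)
open import Relation.Binary.PropositionalEquality
  using (_≡_; refl; sym; trans; cong; cong₂; subst; subst₂; module ≡-Reasoning)
import Relation.Binary.Reasoning.Setoid as SetoidReasoning

module _ {L : Signature} (M : Structure L) where

  SameQftp-isEquivalence : ∀ {n} → IsEquivalence (SameQftp M {n})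
  SameQftp-isEquivalence = record
    { refl  = λ φ → ⇔.refl
    ; sym   = λ s φ → ⇔.sym (s φ)
    ; trans = λ s t φ → ⇔.trans (s φ) (t φ)
    }
    where module ⇔ = IsEquivalence ⇔-isEquivalence

  SameQftp-setoid : ℕ → Setoid _ _
  SameQftp-setoid n = record { isEquivalence = SameQftp-isEquivalence {n} }

module _ {L : Signature} (M : Structure L) {h : Carrier M → Carrier M}
         (h-embedding : IsEmbedding M h) where

  private
    h-injective = proj₁ h-embedding
    h-relI      = proj₁ (proj₂ h-embedding)
    h-funI      = proj₂ (proj₂ h-embedding)

  mutual
    eval-embedding : ∀ {n} (t : Term L n) (a : Vec (Carrier M) n) →
                     eval M t (map h a) ≡ h (eval M t a)
    eval-embedding (var i)    a = lookup-map i h a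
    eval-embedding (app F ts) a =
      trans (cong (funI M F) (evals-embedding ts a)) (sym (h-funI F (evals M ts a)))

    evals-embedding : ∀ {n k} (ts : Vec (Term L n) k) (a : Vec (Carrier M) n) →
                      evals M ts (map h a) ≡ map h (evals M ts a)
    evals-embedding []       a = refl
    evals-embedding (t ∷ ts) a = cong₂ _∷_ (eval-embedding t a) (evals-embedding ts a)

  Sat-embedding : ∀ {n} (φ : QF L n) (a : Vec (Carrier M) n) →
                  Sat M φ a ⇔ Sat M φ (map h a)
  Sat-embedding (s ≐ t)    a =
    subst₂ (λ x y → (eval M s a ≡ eval M t a) ⇔ (x ≡ y))
      (sym (eval-embedding s a)) (sym (eval-embedding t a)) (mk⇔ (cong h) h-injective)
  Sat-embedding (rel R ts) a =
    subst (λ xs → Sat M (rel R ts) a ⇔ relI M R xs)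
      (sym (evals-embedding ts a)) (h-relI R (evals M ts a))
  Sat-embedding (¬' φ)     a = ¬-cong-⇔ (Sat-embedding φ a)
  Sat-embedding (φ ∧' ψ)   a = Sat-embedding φ a ×-⇔ Sat-embedding ψ a

  embedding⇒SameQftp : ∀ {n} (a : Vec (Carrier M) n) → SameQftp M a (map h a)
  embedding⇒SameQftp a φ = Sat-embedding φ a

module _ {L L' : Signature} (A : Structure L) (B : Structure L')
         (h : Carrier A → Carrier B) where

  private
    hTup : TupObj A → TupObj B
    hTup = mapTup {A = A} {B = B} h

  imageRan : ∀ {a : TupObj A} → Ran A a → Ran B (hTup a)
  imageRan {_ , a} (x , x∈a) = h x , ∈-map⁺ h x∈a

  ∈-map⁻ : ∀ {n} {a : Vec (Carrier A) n} {y} → y ∈ map h a →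
           ∃ λ x → x ∈ a × y ≡ h x
  ∈-map⁻ y∈ha = find (map⁻ y∈ha)

  preimageRan : ∀ {a : TupObj A} → Ran B (hTup a) → Ran A a
  preimageRan {_ , a} (y , y∈ha) = let x , x∈a , _ = ∈-map⁻ y∈ha in x , x∈a

  image-preimageRan : ∀ {a : TupObj A} (y : Ran B (hTup a)) →
                      h (proj₁ (preimageRan y)) ≡ proj₁ y
  image-preimageRan {_ , a} (y , y∈ha) = sym (proj₂ (proj₂ (∈-map⁻ y∈ha)))

  module _ (h-respecting : QftpRespecting A B h) where

    private
      h-injective = proj₁ h-respecting
      pre         = preimageRan
      h∘pre       = image-preimageRan

    mapHom : ∀ {a b : TupObj A} → TupHom A a b → TupHom B (hTup a) (hTup b)
    fun (mapHom φ) = imageRan ∘ fun φ ∘ pre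
    wd  (mapHom φ) y y′ y≡y′ =
      cong h (wd φ _ _ (h-injective (trans (h∘pre y) (trans y≡y′ (sym (h∘pre y′))))))
    inj (mapHom φ) y y′ eq =
      trans (sym (h∘pre y)) (trans (cong h (inj φ _ _ (h-injective eq))) (h∘pre y′))
    pres (mapHom φ) k ys = begin
      map proj₁ ys                              ≡⟨ map-cong (sym ∘ h∘pre) ys ⟩
      map (h ∘ proj₁ ∘ pre) ys                  ≡⟨ map-∘ (h ∘ proj₁) pre ys ⟩
      map (h ∘ proj₁) (map pre ys)              ≡⟨ map-∘ h proj₁ (map pre ys) ⟩
      map h (map proj₁ (map pre ys))            ≈⟨ proj₂ h-respecting k _ _ (pres φ k (map pre ys)) ⟩
      map h (map (proj₁ ∘ fun φ) (map pre ys))  ≡⟨ map-∘ h (proj₁ ∘ fun φ) (map pre ys) ⟨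
      map (h ∘ proj₁ ∘ fun φ) (map pre ys)      ≡⟨ map-∘ (h ∘ proj₁ ∘ fun φ) pre ys ⟨
      map (proj₁ ∘ fun (mapHom φ)) ys           ∎
      where open SetoidReasoning (SameQftp-setoid B k)

    mapHom-imageRan : ∀ {a b : TupObj A} (φ : TupHom A a b) (x : Ran A a) →
                      proj₁ (fun (mapHom φ) (imageRan x)) ≡ h (proj₁ (fun φ x))
    mapHom-imageRan {_ , _} φ x = cong h (wd φ _ _ (h-injective (h∘pre (imageRan x))))

module _ {L L' : Signature} (A : Structure L) (B : Structure L')
         {g : Carrier A → Carrier B} {f : Carrier B → Carrier A}
         (fg-embedding : IsEmbedding A (f ∘ g)) where

  unitHom : ∀ {a : TupObj A} →
            TupHom A a (mapTup {A = B} {B = A} f (mapTup {A = A} {B = B} g a))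
  fun  unitHom        = imageRan B A f ∘ imageRan A B g
  wd   unitHom _ _ eq = cong (f ∘ g) eq
  inj  unitHom _ _ eq = proj₁ fg-embedding eq
  pres unitHom k xs   = begin
    map proj₁ xs                ≈⟨ embedding⇒SameQftp A fg-embedding (map proj₁ xs) ⟩
    map (f ∘ g) (map proj₁ xs)  ≡⟨ map-∘ (f ∘ g) proj₁ xs ⟨
    map (proj₁ ∘ fun unitHom) xs ∎
    where open SetoidReasoning (SameQftp-setoid A k)

theorem6p3 : {L L' : Signature} (A : Structure L) (B : Structure L')
    (g : Carrier A → Carrier B) (f : Carrier B → Carrier A) →
    IsSemiRetraction A B g f →
    IsPreAdjunction (TupCat B) (TupCat A) (mapTup {A = A} {B = B} g) (mapTup {A = B} {B = A} f)
theorem6p3 A B g f (g-respecting , f-respecting , fg-embedding) =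
  Φ , λ a b X v ψ → mapHom A B g g-respecting v , Φ-natural v ψ
  where
  F : TupObj A → TupObj B
  F = mapTup {A = A} {B = B} g

  G : TupObj B → TupObj A
  G = mapTup {A = B} {B = A} f

  Φ : ∀ a X → TupHom B (F a) X → TupHom A a (G X)
  Φ a X ψ = _∘T_ A (mapHom B A f f-respecting ψ) (unitHom A B fg-embedding)

  Φ-natural : ∀ {a b X} (v : TupHom A a b) (ψ : TupHom B (F b) X) →
              _≈T_ A (Φ a X (_∘T_ B ψ (mapHom A B g g-respecting v))) (_∘T_ A (Φ b X ψ) v)
  Φ-natural {a} {b} {X} v ψ x = begin
    proj₁ (fun (Φ a X (_∘T_ B ψ w)) x)
      ≡⟨ mapHom-imageRan B A f f-respecting (_∘T_ B ψ w) (imageRan A B g x) ⟩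
    f (proj₁ (fun ψ (fun w (imageRan A B g x))))
      ≡⟨ cong f (wd ψ _ _ (mapHom-imageRan A B g g-respecting v x)) ⟩
    f (proj₁ (fun ψ (imageRan A B g (fun v x))))
      ≡⟨ mapHom-imageRan B A f f-respecting ψ (imageRan A B g (fun v x)) ⟨
    proj₁ (fun (_∘T_ A (Φ b X ψ) v) x)
      ∎
    where
    open ≡-Reasoning
    w : TupHom B (F a) (F b)
    w = mapHom A B g g-respecting v
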